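{- For each graph $G$ there is a graph $G'$ of minimum order such that $G$ is a blow-up of $G'$, and this graph $G'$ is unique up to isomorphism.
   Context: All graphs are finite and simple. For a graph $G'$ with vertices $v_1,\ldots,v_n$ and graphs $H_1,\ldots,H_n$, the composition $G'[H_1,\ldots,H_n]$ has vertex set the disjoint union of the $V(H_i)$, and $uv$ is an edge iff either $uv \in E(H_i)$ for some $i$, or $u \in V(H_i)$, $v \in V(H_j)$ for distinct $i,j$ with $v_iv_j \in E(G')$. If every $H_i$ is a complete graph or an edgeless graph on at least one vertex, this graph is called a blow-up of $G'$, and $G$ is a blow-up of $G'$ if it is isomorphic to such a graph. -}

module Defs where

open import Data.Nat using (ℕ; suc)
open import Data.Fin using (Fin)
open import Data.Fin.Properties using (_≟_)
open import Data.Bool using (Bool; true; false; _∧_; not; if_then_else_)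
open import Data.Product using (Σ; _×_; _,_; proj₁; proj₂; ∃)
open import Relation.Binary.PropositionalEquality using (_≡_; refl)
open import Relation.Nullary using (yes; no)
open import Data.Empty using (⊥-elim)
open import Data.Bool.Properties using (∧-zeroʳ)
open import Relation.Nullary.Decidable using (⌊_⌋)
open import Function.Bundles using (_↔_; Inverse)

record Graph (V : Set) : Set where
  field
    adj   : V → V → Bool
    sym   : ∀ u v → adj u v ≡ adj v u
    irref : ∀ v → adj v v ≡ false
open Graph public

record _≅_ {V W : Set} (G : Graph V) (H : Graph W) : Set where
  field
    bij      : V ↔ W
    preserve : ∀ u v → adj G u v ≡ adj H (Inverse.to bij u) (Inverse.to bij v)

-- Composition G'[H_1,...,H_k]; vertex set is the disjoint union
-- Σ (i : Fin k) V(H_i), where V(H_i) = Fin (s i).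
compVertex : (k : ℕ) (s : Fin k → ℕ) → Set
compVertex k s = Σ (Fin k) (λ i → Fin (s i))

compAdj : {k : ℕ} → Graph (Fin k) → (s : Fin k → ℕ) → ((i : Fin k) → Graph (Fin (s i)))
        → compVertex k s → compVertex k s → Bool
compAdj {k} G' s H (i , x) (j , y) with i ≟ j
... | yes refl = adj (H i) x y
... | no _ = adj G' i j


compAdj-sym : {k : ℕ} (G' : Graph (Fin k)) (s : Fin k → ℕ) (H : (i : Fin k) → Graph (Fin (s i)))
            → ∀ u v → compAdj G' s H u v ≡ compAdj G' s H v u
compAdj-sym G' s H (i , x) (j , y) with i ≟ j | j ≟ i
... | yes refl | yes refl = Graph.sym (H i) x y
... | yes refl | no ne = ⊥-elim (ne refl)
... | no ne | yes refl = ⊥-elim (ne refl)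
... | no _ | no _ = Graph.sym G' i j

compAdj-irref : {k : ℕ} (G' : Graph (Fin k)) (s : Fin k → ℕ) (H : (i : Fin k) → Graph (Fin (s i)))
              → ∀ v → compAdj G' s H v v ≡ false
compAdj-irref G' s H (i , x) with i ≟ i
... | yes refl = irref (H i) x
... | no ne = ⊥-elim (ne refl)

composition : {k : ℕ} → Graph (Fin k) → (s : Fin k → ℕ) → ((i : Fin k) → Graph (Fin (s i)))
            → Graph (compVertex k s)
composition G' s H = record
  { adj = compAdj G' s H ; sym = compAdj-sym G' s H ; irref = compAdj-irref G' s H }

completeOrEdgeless : Bool → (m : ℕ) → Graph (Fin m)
completeOrEdgeless b m = record
  { adj = λ x y → b ∧ not ⌊ x ≟ y ⌋
  ; sym = λ x y → symLemma x y
  ; irref = λ x → irrefLemma x }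
  where
    symLemma : ∀ x y → (b ∧ not ⌊ x ≟ y ⌋) ≡ (b ∧ not ⌊ y ≟ x ⌋)
    symLemma x y with x ≟ y | y ≟ x
    ... | yes refl | yes _ = refl
    ... | yes refl | no ne = ⊥-elim (ne refl)
    ... | no ne | yes refl = ⊥-elim (ne refl)
    ... | no _ | no _ = refl
    irrefLemma : ∀ x → (b ∧ not ⌊ x ≟ x ⌋) ≡ false
    irrefLemma x with x ≟ x
    ... | yes _ = ∧-zeroʳ b
    ... | no ne = ⊥-elim (ne refl)

IsBlowUpOf : {V : Set} {k : ℕ} → Graph V → Graph (Fin k) → Set
IsBlowUpOf {V} {k} G G' =
  Σ (Fin k → ℕ) λ m → Σ (Fin k → Bool) λ b →
    G ≅ composition G' (λ i → suc (m i)) (λ i → completeOrEdgeless (b i) (suc (m i)))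

module Submission where

-- Call u and v twins if they have the same neighbours outside {u, v}. Twinship is an
-- equivalence relation, and G is a blow-up of the graph G/~ obtained by keeping one vertex
-- per twin class: a class induces a clique or an independent set, and two classes are either
-- completely joined or not joined at all. Conversely, each part of any blow-up of G consists
-- of twins, so sending a twin class to the part of its representative is injective. Hence
-- G/~ has the fewest vertices, and a blow-up of G″ with equally many parts makes this map a
-- bijection, which preserves adjacency.

open import Defs
open import Level using (0ℓ)
open import Data.Nat using (ℕ; zero; suc; _≤_; _+_)
open import Data.Fin using (Fin; zero; suc; punchOut)
open import Data.Fin.Properties using (_≟_; any?; all?; suc-injective; punchOut-injective; injective⇒≤; +↔⊎)
open import Data.Nat.Properties using (1+n≰n)
open import Data.Bool using (Bool; false)
import Data.Bool.Properties as Bool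
open import Data.Bool.Properties using (∧-identityʳ)
open import Data.Product using (Σ; ∃; _×_; _,_; proj₁; proj₂)
open import Data.Product.Function.Dependent.Propositional using (congˡ)
open import Function.Related.Propositional using (bijection)
open import Data.Sum using (_⊎_; inj₁; inj₂)
open import Data.Sum.Function.Propositional using (_⊎-↔_)
open import Data.Empty using (⊥-elim)
open import Function.Base using (_∘_; _on_)
open import Function.Bundles using (_↔_; Inverse; Injection; mk↔ₛ′)
open import Function.Properties.Inverse using (↔⇒↣)
open import Function.Construct.Composition using (_↔-∘_)
open import Function.Construct.Symmetry using (↔-sym)
open import Function.Definitions using (Injective)
open import Relation.Binary.Core using (Rel)
open import Relation.Binary.Structures using (IsEquivalence; IsDecEquivalence)
open import Relation.Binary.Definitions using (Decidable)
import Relation.Binary.Construct.On as On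
open import Relation.Binary.PropositionalEquality
  using (_≡_; _≢_; refl; trans; cong; module ≡-Reasoning)
  renaming (sym to ≡-sym)
open import Relation.Nullary using (Dec; yes; no; ¬_; ¬?; _→-dec_; _×-dec_)
open import Relation.Nullary.Irrelevant using (Irrelevant)
open import Relation.Unary using (Pred) renaming (Decidable to Decidable₁; Irrelevant to Irrelevant₁)
open import Axiom.UniquenessOfIdentityProofs using (module Decidable⇒UIP)

Twin : {n : ℕ} → Graph (Fin n) → Rel (Fin n) 0ℓ
Twin G u v = ∀ w → w ≢ u → w ≢ v → adj G u w ≡ adj G v w

Twin-isDecEquivalence : {n : ℕ} (G : Graph (Fin n)) → IsDecEquivalence (Twin G)
Twin-isDecEquivalence G = record
  { isEquivalence = record { refl = λ _ _ _ → refl ; sym = twin-sym ; trans = twin-trans }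
  ; _≟_ = twin?
  }
  where
  open ≡-Reasoning
  twin? : Decidable (Twin G)
  twin? u v = all? λ w → ¬? (w ≟ u) →-dec ¬? (w ≟ v) →-dec adj G u w Bool.≟ adj G v w

  twin-sym : ∀ {u v} → Twin G u v → Twin G v u
  twin-sym u~v w w≢v w≢u = ≡-sym (u~v w w≢u w≢v)

  twin-trans : ∀ {u v w} → Twin G u v → Twin G v w → Twin G u w
  twin-trans {u} {v} {w} u~v v~w x x≢u x≢w with x ≟ v | u ≟ w
  ... | no x≢v | _ = trans (u~v x x≢u x≢v) (v~w x x≢v x≢w)
  ... | yes refl | yes refl = refl
  ... | yes refl | no u≢w = begin
    adj G u x  ≡⟨ Graph.sym G u x ⟩
    adj G x u  ≡⟨ v~w u (x≢u ∘ ≡-sym) u≢w ⟩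
    adj G w u  ≡⟨ Graph.sym G w u ⟩
    adj G u w  ≡⟨ u~v w (u≢w ∘ ≡-sym) (x≢w ∘ ≡-sym) ⟩
    adj G x w  ≡⟨ Graph.sym G x w ⟩
    adj G w x  ∎

module _ {n : ℕ} (G : Graph (Fin n)) where
  open IsDecEquivalence (Twin-isDecEquivalence G)
    using () renaming (refl to ~-refl; sym to ~-sym; trans to ~-trans)
  open ≡-Reasoning

  Twin-adj-between : ∀ {u u′ v v′} → ¬ Twin G u v → Twin G u u′ → Twin G v v′ → adj G u v ≡ adj G u′ v′
  Twin-adj-between {u} {u′} {v} {v′} u≁v u~u′ v~v′ = begin
    adj G u v    ≡⟨ u~u′ v v≢u v≢u′ ⟩
    adj G u′ v   ≡⟨ Graph.sym G u′ v ⟩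
    adj G v u′   ≡⟨ v~v′ u′ (v≢u′ ∘ ≡-sym) u′≢v′ ⟩
    adj G v′ u′  ≡⟨ Graph.sym G v′ u′ ⟩
    adj G u′ v′  ∎
    where
    v≢u : v ≢ u
    v≢u refl = u≁v ~-refl
    v≢u′ : v ≢ u′
    v≢u′ refl = u≁v u~u′
    u′≢v′ : u′ ≢ v′
    u′≢v′ refl = u≁v (~-trans u~u′ (~-sym v~v′))

  Twin-adj-within : ∀ {u v x y} → Twin G u x → Twin G u y → Twin G v y → u ≢ v → x ≢ y →
                    adj G u v ≡ adj G x y
  Twin-adj-within {u} {v} {x} {y} u~x u~y v~y u≢v x≢y with v ≟ x
  ... | yes refl = begin
    adj G u v  ≡⟨ u~y v (u≢v ∘ ≡-sym) x≢y ⟩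
    adj G y v  ≡⟨ Graph.sym G y v ⟩
    adj G v y  ∎
  ... | no v≢x = begin
    adj G u v  ≡⟨ u~x v (u≢v ∘ ≡-sym) v≢x ⟩
    adj G x v  ≡⟨ Graph.sym G x v ⟩
    adj G v x  ≡⟨ v~y x (v≢x ∘ ≡-sym) x≢y ⟩
    adj G y x  ≡⟨ Graph.sym G y x ⟩
    adj G x y  ∎

record Quotient {n : ℕ} (R : Rel (Fin n) 0ℓ) : Set where
  field
    size           : ℕ
    class          : Fin n → Fin size
    rep            : Fin size → Fin n
    class-rep      : ∀ i → class (rep i) ≡ i
    class-sound    : ∀ {u v} → class u ≡ class v → R u v
    class-complete : ∀ {u v} → R u v → class u ≡ class v

module ExtendQuotient {n : ℕ} {R : Rel (Fin (suc n)) 0ℓ}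
                      (R-equiv : IsEquivalence R) (Q : Quotient (R on suc)) where
  open IsEquivalence R-equiv renaming (refl to R-refl; sym to R-sym; trans to R-trans)
  open Quotient Q

  joining : ∀ {v₀} → R zero (suc v₀) → Quotient R
  joining {v₀} 0~v₀ = record
    { size = size ; class = class′ ; rep = suc ∘ rep ; class-rep = class-rep
    ; class-sound = sound′ ; class-complete = complete′ }
    where
    class′ : Fin (suc n) → Fin size
    class′ zero    = class v₀
    class′ (suc u) = class u

    sound′ : ∀ {u v} → class′ u ≡ class′ v → R u v
    sound′ {zero}  {zero}  _ = R-refl
    sound′ {zero}  {suc v} e = R-trans 0~v₀ (class-sound e)
    sound′ {suc u} {zero}  e = R-trans (class-sound e) (R-sym 0~v₀)
    sound′ {suc u} {suc v} e = class-sound e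

    complete′ : ∀ {u v} → R u v → class′ u ≡ class′ v
    complete′ {zero}  {zero}  _   = refl
    complete′ {zero}  {suc v} 0~v = class-complete (R-trans (R-sym 0~v₀) 0~v)
    complete′ {suc u} {zero}  u~0 = class-complete (R-trans u~0 0~v₀)
    complete′ {suc u} {suc v} u~v = class-complete u~v

  fresh : (∀ v → ¬ R zero (suc v)) → Quotient R
  fresh 0≁ = record
    { size = suc size ; class = class′ ; rep = rep′ ; class-rep = class-rep′
    ; class-sound = sound′ ; class-complete = complete′ }
    where
    class′ : Fin (suc n) → Fin (suc size)
    class′ zero    = zero
    class′ (suc u) = suc (class u)

    rep′ : Fin (suc size) → Fin (suc n)
    rep′ zero    = zero
    rep′ (suc i) = suc (rep i)

    class-rep′ : ∀ i → class′ (rep′ i) ≡ i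
    class-rep′ zero    = refl
    class-rep′ (suc i) = cong suc (class-rep i)

    sound′ : ∀ {u v} → class′ u ≡ class′ v → R u v
    sound′ {zero}  {zero}  _ = R-refl
    sound′ {suc u} {suc v} e = class-sound (suc-injective e)

    complete′ : ∀ {u v} → R u v → class′ u ≡ class′ v
    complete′ {zero}  {zero}  _   = refl
    complete′ {zero}  {suc v} 0~v = ⊥-elim (0≁ v 0~v)
    complete′ {suc u} {zero}  u~0 = ⊥-elim (0≁ u (R-sym u~0))
    complete′ {suc u} {suc v} u~v = cong suc (class-complete u~v)

quotient : ∀ {n} {R : Rel (Fin n) 0ℓ} → IsDecEquivalence R → Quotient R
quotient {zero} _ = record
  { size = 0 ; class = λ () ; rep = λ () ; class-rep = λ ()
  ; class-sound = λ { {()} } ; class-complete = λ { {()} } }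
quotient {suc n} {R} R-dec = extend (any? λ v → zero ≟ᴿ suc v)
  where
  open IsDecEquivalence R-dec using (isEquivalence) renaming (_≟_ to _≟ᴿ_)
  open ExtendQuotient isEquivalence (quotient (On.isDecEquivalence suc R-dec))

  extend : Dec (∃ λ v → R zero (suc v)) → Quotient R
  extend (yes (_ , 0~v)) = joining 0~v
  extend (no 0≁)         = fresh λ v 0~v → 0≁ (v , 0~v)

Dec↔Fin : {A : Set} → Dec A → Irrelevant A → Σ ℕ λ c → A ↔ Fin c
Dec↔Fin (yes a) a-irr = 1 , mk↔ₛ′ (λ _ → zero) (λ _ → a) (λ { zero → refl }) (a-irr a)
Dec↔Fin (no ¬a) _     = 0 , mk↔ₛ′ (⊥-elim ∘ ¬a) (λ ()) (λ ()) (⊥-elim ∘ ¬a)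

Σ-Fin-suc↔⊎ : ∀ {n} (P : Pred (Fin (suc n)) 0ℓ) → Σ (Fin (suc n)) P ↔ (P zero ⊎ Σ (Fin n) (P ∘ suc))
Σ-Fin-suc↔⊎ P = mk↔ₛ′ to from
  (λ { (inj₁ _) → refl ; (inj₂ _) → refl })
  (λ { (zero , _) → refl ; (suc _ , _) → refl })
  where
  to : Σ (Fin _) P → P zero ⊎ Σ (Fin _) (P ∘ suc)
  to (zero  , p) = inj₁ p
  to (suc u , p) = inj₂ (u , p)
  from : P zero ⊎ Σ (Fin _) (P ∘ suc) → Σ (Fin _) P
  from (inj₁ p)       = zero , p
  from (inj₂ (u , p)) = suc u , p

Σ-Fin↔Fin : ∀ {n} {P : Pred (Fin n) 0ℓ} → Decidable₁ P → Irrelevant₁ P → Σ ℕ λ c → Σ (Fin n) P ↔ Fin c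
Σ-Fin↔Fin {zero} _ _ = 0 , mk↔ₛ′ (λ ()) (λ ()) (λ ()) (λ ())
Σ-Fin↔Fin {suc n} {P} P? P-irr
  with a , P0↔a ← Dec↔Fin (P? zero) P-irr
     | c , rest↔c ← Σ-Fin↔Fin {P = P ∘ suc} (P? ∘ suc) P-irr
  = a + c , ↔-sym +↔⊎ ↔-∘ ((P0↔a ⊎-↔ rest↔c) ↔-∘ Σ-Fin-suc↔⊎ P)

inhabited-Σ-Fin↔Fin : ∀ {n} {P : Pred (Fin n) 0ℓ} → Decidable₁ P → Irrelevant₁ P →
                      Σ (Fin n) P → Σ ℕ λ m → Σ (Fin n) P ↔ Fin (suc m)
inhabited-Σ-Fin↔Fin P? P-irr x with Σ-Fin↔Fin P? P-irr
... | suc m , e = m , e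
... | zero  , e with () ← Inverse.to e x

Σ-fibres↔ : {A B : Set} (f : A → B) → A ↔ Σ B λ b → Σ A λ a → f a ≡ b
Σ-fibres↔ f = mk↔ₛ′ (λ a → f a , a , refl) (λ { (_ , a , _) → a }) (λ { (_ , _ , refl) → refl }) (λ _ → refl)

Fin-injective⇒surjective : ∀ {k} {f : Fin k → Fin k} → Injective _≡_ _≡_ f → ∀ j → ∃ λ i → f i ≡ j
Fin-injective⇒surjective {suc k} {f} f-inj j with any? (λ i → f i ≟ j)
... | yes hit = hit
... | no miss = ⊥-elim (1+n≰n (injective⇒≤ {f = f-avoiding-j} f-avoiding-j-injective))
  where
  j≢f : ∀ i → j ≢ f i
  j≢f i j≡fi = miss (i , ≡-sym j≡fi)
  f-avoiding-j : Fin (suc k) → Fin k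
  f-avoiding-j i = punchOut (j≢f i)
  f-avoiding-j-injective : Injective _≡_ _≡_ f-avoiding-j
  f-avoiding-j-injective e = f-inj (punchOut-injective (j≢f _) (j≢f _) e)

-- A blow-up presented by its partition into parts; rep witnesses that no part is empty.
record BlowUpMap {n k : ℕ} (G : Graph (Fin n)) (G′ : Graph (Fin k)) : Set where
  field
    part        : Fin n → Fin k
    rep         : Fin k → Fin n
    part-rep    : ∀ i → part (rep i) ≡ i
    inner       : Fin k → Bool
    adj-between : ∀ u v → part u ≢ part v → adj G u v ≡ adj G′ (part u) (part v)
    adj-within  : ∀ u v → part u ≡ part v → u ≢ v → adj G u v ≡ inner (part u)

  samePart⇒Twin : ∀ {u v} → part u ≡ part v → Twin G u v
  samePart⇒Twin {u} {v} u≈v w w≢u w≢v with part w ≟ part u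
  ... | yes w≈u = begin
    adj G u w        ≡⟨ Graph.sym G u w ⟩
    adj G w u        ≡⟨ adj-within w u w≈u w≢u ⟩
    inner (part w)   ≡⟨ adj-within w v (trans w≈u u≈v) w≢v ⟨
    adj G w v        ≡⟨ Graph.sym G w v ⟩
    adj G v w        ∎
    where open ≡-Reasoning
  ... | no w≉u = begin
    adj G u w                 ≡⟨ adj-between u w (w≉u ∘ ≡-sym) ⟩
    adj G′ (part u) (part w)  ≡⟨ cong (λ i → adj G′ i (part w)) u≈v ⟩
    adj G′ (part v) (part w)  ≡⟨ adj-between v w (w≉u ∘ ≡-sym ∘ trans u≈v) ⟨
    adj G v w                 ∎
    where open ≡-Reasoning

module _ {k : ℕ} (G′ : Graph (Fin k)) (m : Fin k → ℕ) (b : Fin k → Bool) where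
  private
    s : Fin k → ℕ
    s i = suc (m i)
    H : (i : Fin k) → Graph (Fin (s i))
    H i = completeOrEdgeless (b i) (s i)

  compAdj-between : ∀ x y → proj₁ x ≢ proj₁ y → compAdj G′ s H x y ≡ adj G′ (proj₁ x) (proj₁ y)
  compAdj-between (i , _) (j , _) i≢j with i ≟ j
  ... | yes i≡j = ⊥-elim (i≢j i≡j)
  ... | no _    = refl

  compAdj-within : ∀ x y → proj₁ x ≡ proj₁ y → x ≢ y → compAdj G′ s H x y ≡ b (proj₁ x)
  compAdj-within (i , x) (j , y) i≡j x≢y with i ≟ j
  ... | no i≢j  = ⊥-elim (i≢j i≡j)
  ... | yes refl with x ≟ y
  ...   | yes refl = ⊥-elim (x≢y refl)
  ...   | no _     = ∧-identityʳ (b i)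

IsBlowUpOf⇒BlowUpMap : ∀ {n k} {G : Graph (Fin n)} {G′ : Graph (Fin k)} → IsBlowUpOf G G′ → BlowUpMap G G′
IsBlowUpOf⇒BlowUpMap {G′ = G′} (m , b , iso) = record
  { part        = proj₁ ∘ to
  ; rep         = λ i → from (i , zero)
  ; part-rep    = λ i → cong proj₁ (strictlyInverseˡ (i , zero))
  ; inner       = b
  ; adj-between = λ u v u≉v → trans (preserve u v) (compAdj-between G′ m b (to u) (to v) u≉v)
  ; adj-within  = λ u v u≈v u≢v →
      trans (preserve u v) (compAdj-within G′ m b (to u) (to v) u≈v (u≢v ∘ Injection.injective (↔⇒↣ bij)))
  }
  where
  open _≅_ iso
  open Inverse bij

BlowUpMap⇒IsBlowUpOf : ∀ {n k} {G : Graph (Fin n)} {G′ : Graph (Fin k)} → BlowUpMap G G′ → IsBlowUpOf G G′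
BlowUpMap⇒IsBlowUpOf {n} {k} {G} {G′} P = m , inner , record { bij = bij ; preserve = preserve }
  where
  open BlowUpMap P

  fibre↔Fin : ∀ i → Σ ℕ λ m → Σ (Fin n) (λ u → part u ≡ i) ↔ Fin (suc m)
  fibre↔Fin i =
    inhabited-Σ-Fin↔Fin (λ u → part u ≟ i) (Decidable⇒UIP.≡-irrelevant _≟_) (rep i , part-rep i)

  m : Fin k → ℕ
  m = proj₁ ∘ fibre↔Fin

  bij : Fin n ↔ compVertex k (suc ∘ m)
  bij = congˡ {k = bijection} (proj₂ (fibre↔Fin _)) ↔-∘ Σ-fibres↔ part

  open Inverse bij using (to)

  G[H] : Graph (compVertex k (suc ∘ m))
  G[H] = composition G′ (suc ∘ m) (λ i → completeOrEdgeless (inner i) (suc (m i)))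

  preserve : ∀ u v → adj G u v ≡ adj G[H] (to u) (to v)
  preserve u v = by-cases (part u ≟ part v) (u ≟ v)
    where
    by-cases : Dec (part u ≡ part v) → Dec (u ≡ v) → adj G u v ≡ adj G[H] (to u) (to v)
    by-cases (no u≉v)  _          = trans (adj-between u v u≉v)
      (≡-sym (compAdj-between G′ m inner (to u) (to v) u≉v))
    by-cases (yes _)   (yes refl) = trans (irref G u) (≡-sym (irref G[H] (to u)))
    by-cases (yes u≈v) (no u≢v)   = trans (adj-within u v u≈v u≢v)
      (≡-sym (compAdj-within G′ m inner (to u) (to v) u≈v (u≢v ∘ Injection.injective (↔⇒↣ bij))))

module TwinQuotient {n : ℕ} (G : Graph (Fin n)) where
  open Quotient (quotient (Twin-isDecEquivalence G))

  quotientGraph : Graph (Fin size)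
  quotientGraph = record
    { adj = λ i j → adj G (rep i) (rep j)
    ; sym = λ i j → Graph.sym G (rep i) (rep j)
    ; irref = irref G ∘ rep
    }

  private
    Twin-rep : ∀ {u i} → class u ≡ i → Twin G u (rep i)
    Twin-rep u∈i = class-sound (trans u∈i (≡-sym (class-rep _)))

    -- A singleton class is complete and edgeless at once; it is declared edgeless.
    another? : ∀ i → Dec (∃ λ v → class v ≡ i × v ≢ rep i)
    another? i = any? λ v → class v ≟ i ×-dec ¬? (v ≟ rep i)

    inner : Fin size → Bool
    inner i with another? i
    ... | yes (v , _) = adj G (rep i) v
    ... | no _        = false

    adj-within : ∀ u v → class u ≡ class v → u ≢ v → adj G u v ≡ inner (class u)
    adj-within u v u≈v u≢v with another? (class u)
    ... | yes (w , w∈u , w≢rep) = Twin-adj-within G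
      (Twin-rep refl) (class-sound (≡-sym w∈u)) (class-sound (≡-sym (trans w∈u u≈v))) u≢v (w≢rep ∘ ≡-sym)
    ... | no ∄another with u ≟ rep (class u)
    ...   | no u≢rep = ⊥-elim (∄another (u , refl , u≢rep))
    ...   | yes u≡rep = ⊥-elim (∄another (v , ≡-sym u≈v , u≢v ∘ trans u≡rep ∘ ≡-sym))

  quotientBlowUpMap : BlowUpMap G quotientGraph
  quotientBlowUpMap = record
    { part        = class
    ; rep         = rep
    ; part-rep    = class-rep
    ; inner       = inner
    ; adj-between = λ u v u≉v →
        Twin-adj-between G (u≉v ∘ class-complete) (Twin-rep refl) (Twin-rep refl)
    ; adj-within  = adj-within
    }

  module _ {k : ℕ} {G′ : Graph (Fin k)} (P : BlowUpMap G G′) where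
    private module P = BlowUpMap P

    embed : Fin size → Fin k
    embed = P.part ∘ rep

    retract∘embed : ∀ i → class (P.rep (embed i)) ≡ i
    retract∘embed i = trans (class-complete (P.samePart⇒Twin (P.part-rep (embed i)))) (class-rep i)

    embed-injective : Injective _≡_ _≡_ embed
    embed-injective {i} {j} e = begin
      i                        ≡⟨ retract∘embed i ⟨
      class (P.rep (embed i))  ≡⟨ cong (class ∘ P.rep) e ⟩
      class (P.rep (embed j))  ≡⟨ retract∘embed j ⟩
      j                        ∎
      where open ≡-Reasoning

    size-minimal : size ≤ k
    size-minimal = injective⇒≤ embed-injective

  quotientGraph-unique : {G′ : Graph (Fin size)} → BlowUpMap G G′ → quotientGraph ≅ G′
  quotientGraph-unique {G′} P = record
    { bij = mk↔ₛ′ (embed P) (class ∘ BlowUpMap.rep P) embed∘retract (retract∘embed P)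
    ; preserve = preserve
    }
    where
    embed∘retract : ∀ j → embed P (class (BlowUpMap.rep P j)) ≡ j
    embed∘retract j with Fin-injective⇒surjective (embed-injective P) j
    ... | i , refl = cong (embed P) (retract∘embed P i)

    preserve : ∀ i j → adj quotientGraph i j ≡ adj G′ (embed P i) (embed P j)
    preserve i j with i ≟ j
    ... | yes refl = trans (irref quotientGraph i) (≡-sym (irref G′ (embed P i)))
    ... | no i≢j   = BlowUpMap.adj-between P (rep i) (rep j) (i≢j ∘ embed-injective P)

lemma6p1 : (n : ℕ) (G : Graph (Fin n)) →
    Σ ℕ λ k → Σ (Graph (Fin k)) λ G' →
      IsBlowUpOf G G'
      × ((k′ : ℕ) (G″ : Graph (Fin k′)) → IsBlowUpOf G G″ → k ≤ k′)
      × ((G″ : Graph (Fin k)) → IsBlowUpOf G G″ → G' ≅ G″)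
lemma6p1 n G =
  _ , quotientGraph , BlowUpMap⇒IsBlowUpOf quotientBlowUpMap
  , (λ _ _ → size-minimal ∘ IsBlowUpOf⇒BlowUpMap)
  , (λ _ → quotientGraph-unique ∘ IsBlowUpOf⇒BlowUpMap)
  where open TwinQuotient G
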